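{- Let $d\ge 2$, $k,r\ge 1$ be integers and $\rho=2rk-r+k-1$. Let $\mathcal U$ be a degree-$d$ bounded structure and let $\mathcal B\in\mathcal T_{k,r}$ be a $(k,r)$-neighborhood type in which the sphere center constant $c_i$ is interpreted by the element $i$ for every $i\in[k]$, with $m$ connected components. If $\bar a\in\mathcal U^k$ is a $\mathcal B$-tuple, then there are a unique consistent factorization $\Lambda$ of $\mathcal B$ and a unique $m$-tuple $\bar b\in\mathcal U^m$ that is admissible for $\Lambda$ and satisfies $\bar a=\Lambda(\bar b)$.
   Context: Signatures are relational with relation symbols of arity at most two. $\mathcal G(\mathcal U)$ is the Gaifman graph of $\mathcal U$ (edge between $a\ne b$ iff they occur together in some tuple of some relation); $\mathcal U$ is degree-$d$ bounded if $\mathcal G(\mathcal U)$ has maximal degree $\le d$; $\mathrm{dist}_{\mathcal U}$ is the distance in $\mathcal G(\mathcal U)$, extended to sets by taking the minimum, and to partial tuples via their ranges. A partial $k$-tuple over $A$ is a partial map $t:[k]\to A$; disjoint partial tuples $t_1,t_2$ (disjoint domains) have union $t_1\sqcup t_2$. For a partial $k$-tuple $t$, the $r$-sphere $S_r(t)$ is the set of elements at distance $\le r$ from $\mathrm{ran}(t)$, and the $r$-neighborhood $\mathcal N_r^{\mathcal U}(t)$ is the substructure induced by $S_r(t)$ expanded by constants $c_i$ interpreted as $t(i)$ for $i\in\mathrm{dom}(t)$. A $(k,r)$-neighborhood type is a degree-$d$ bounded structure over $\mathcal R\cup\{c_1,\dots,c_k\}$ with universe $[\ell]$, $\ell\le kd^{r+1}$,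 in which every element has distance $\le r$ from some interpretation of a $c_i$; $\mathcal T_{k,r}$ is a fixed set of representatives of the isomorphism classes. A $k$-tuple $\bar a$ is a $\mathcal B$-tuple if $\mathcal N_r^{\mathcal U}(\bar a)\cong\mathcal B$. $\mathcal T_\rho:=\mathcal T_{1,\rho}$ ($\rho$-neighborhood types), where w.l.o.g. $c_1$ is interpreted by $1$; an element $a$ is a $\mathcal B'$-node if $\mathcal N^{\mathcal U}_\rho(a)\cong\mathcal B'$. For every $\mathcal B'\in\mathcal T_\rho$ and every $\mathcal B'$-node $a$, an isomorphism $\pi_a:\mathcal B'\to\mathcal N^{\mathcal U}_\rho(a)$ is fixed (so $\pi_a(1)=a$); for a partial $k$-tuple $\sigma:[k]\to\mathcal B'$ let $t_{a,\sigma}$ be the partial $k$-tuple with $t_{a,\sigma}(j)=\pi_a(\sigma(j))$ for $j\in\mathrm{dom}(\sigma)$. Let $\mathcal C_1,\ldots,\mathcal C_m$ be the connected components of $\mathcal B$ (induced substructures, with the center constants they contain), $D_i=\mathcal C_i\cap[k]$ and $n_i=\min D_i$. A consistent factorization of $\mathcal B$ is a tuple $\Lambda=(\mathcal B_1,\sigma_1,\ldots,\mathcal B_m,\sigma_m)$ with, for all $i\in[m]$: $\mathcal B_i\in\mathcal T_\rho$, $\sigma_i:[k]\to\mathcal B_i$ a partial $k$-tuple with $\mathrm{dom}(\sigma_i)=D_i$ and $\sigma_i(n_i)=1$, and $\mathcal N_r^{\mathcal B_i}(\sigma_i)\cong\mathcal C_i$. An $m$-tuple $(b_1,\ldots,b_m)\in\mathcal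 U^m$ is admissible for $\Lambda$ if each $b_i$ is a $\mathcal B_i$-node and $\mathrm{dist}_{\mathcal U}(t_{b_i,\sigma_i},t_{b_j,\sigma_j})>2r+1$ for all $i\neq j$. Then $\Lambda(\bar b)=t_{b_1,\sigma_1}\sqcup\cdots\sqcup t_{b_m,\sigma_m}$. -}

module Defs where

open import Data.Nat using (ℕ; zero; suc; _+_; _*_; _∸_; _^_; _≤_)
open import Data.Fin using (Fin; zero; suc; _≟_)
open import Data.Bool using (Bool; true; false; not; _∧_; _∨_; T; if_then_else_)
open import Data.List using (List; map; foldr; allFin)
open import Data.Bool.ListAction using (any)
open import Data.Nat.ListAction using (sum)
open import Data.Maybe using (Maybe; just; nothing; _<∣>_)
import Data.Maybe as Maybe
open import Data.Vec using (Vec; lookup)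
open import Data.Product using (Σ; ∃; _×_; _,_; proj₁; proj₂)
open import Data.Unit using (⊤)
open import Relation.Nullary using (¬_)
open import Relation.Nullary.Decidable using (⌊_⌋)
open import Relation.Binary.PropositionalEquality using (_≡_; _≢_)

-- Relational signatures with relation symbols of arity ≤ 2
-- (nZ nullary, nU unary, nB binary symbols).

record Sig : Set where
  field
    nZ nU nB : ℕ

-- A finite structure with universe Fin n (elements 0..n-1 play the
-- role of 1..n).
record Struct (S : Sig) (n : ℕ) : Set where
  open Sig S
  field
    nul : Fin nZ → Bool
    un  : Fin nU → Fin n → Bool
    bin : Fin nB → Fin n → Fin n → Bool
open Struct public

PTuple : ℕ → ℕ → Set
PTuple k n = Fin k → Maybe (Fin n)

one : ∀ {n} → Fin n → PTuple 1 n
one x _ = just x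

Full : ∀ {n} → Fin n → Set
Full _ = ⊤

module _ {S : Sig} where
  open Sig S

  adjB : ∀ {n} → Struct S n → Fin n → Fin n → Bool
  adjB A x y = not ⌊ x ≟ y ⌋ ∧ any (λ R → bin A R x y ∨ bin A R y x) (allFin nB)

  Adj : ∀ {n} → Struct S n → Fin n → Fin n → Set
  Adj A x y = T (adjB A x y)

  deg : ∀ {n} → Struct S n → Fin n → ℕ
  deg {n} A x = sum (map (λ y → if adjB A x y then 1 else 0) (allFin n))

  Bounded : ℕ → ∀ {n} → Struct S n → Set
  Bounded d A = ∀ x → deg A x ≤ d

  -- Within A r x y  :⇔  dist_A(x , y) ≤ r
  data Within {n} (A : Struct S n) : ℕ → Fin n → Fin n → Set where
    here : ∀ {r x} → Within A r x x
    step : ∀ {r x y z} → Adj A x y → Within A r y z → Within A (suc r) x z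

  Connected : ∀ {n} → Struct S n → Fin n → Fin n → Set
  Connected A x y = ∃ λ r → Within A r x y

  Sphere : ∀ {n k} → Struct S n → ℕ → PTuple k n → Fin n → Set
  Sphere A r t x = ∃ λ j → ∃ λ y → t j ≡ just y × Within A r y x

  DistGt : ∀ {n k} → Struct S n → ℕ → PTuple k n → PTuple k n → Set
  DistGt A D t t' = ∀ p q x y → t p ≡ just x → t' q ≡ just y → ¬ Within A D x y

  -- f is an isomorphism from the substructure of A induced by P, expanded
  -- by the (partial) constants c, onto the substructure of A' induced by
  -- P', expanded by the constants c'.
  record IsIso {k n n'} (A : Struct S n) (P : Fin n → Set) (c : PTuple k n)
               (A' : Struct S n') (P' : Fin n' → Set) (c' : PTuple k n')
               (f : Fin n → Fin n') : Set where
    field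
      into     : ∀ x → P x → P' (f x)
      inj      : ∀ x y → P x → P y → f x ≡ f y → x ≡ y
      surj     : ∀ y → P' y → ∃ λ x → P x × f x ≡ y
      nul-pres : ∀ R → nul A R ≡ nul A' R
      un-pres  : ∀ R x → P x → un A R x ≡ un A' R (f x)
      bin-pres : ∀ R x y → P x → P y → bin A R x y ≡ bin A' R (f x) (f y)
      con-pres : ∀ j → Maybe.map f (c j) ≡ c' j

  Iso : ∀ {k n n'} (A : Struct S n) (P : Fin n → Set) (c : PTuple k n)
        (A' : Struct S n') (P' : Fin n' → Set) (c' : PTuple k n') → Set
  Iso A P c A' P' c' = ∃ λ f → IsIso A P c A' P' c' f

  -- r-neighborhood N_r^A(t), given as (A , S_r(t) , t)
  -- (k,r)-neighborhood type (degree bound d), constants c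
  IsNType : (d k r : ℕ) → ∀ {ℓ} → Struct S ℓ → (Fin k → Fin ℓ) → Set
  IsNType d k r {ℓ} A c =
    Bounded d A × ℓ ≤ k * d ^ suc r × (∀ x → ∃ λ j → Within A r (c j) x)

  -- A fixed set T_ρ of representatives of the isomorphism classes of
  -- ρ-neighborhood types (= (1,ρ)-types); the j-th representative has
  -- universe Fin (suc (size j)) and c_1 interpreted by zero (= "1").
  record Reps (d ρ : ℕ) : Set where
    field
      N      : ℕ
      size   : Fin N → ℕ
      str    : (j : Fin N) → Struct S (suc (size j))
      isType : ∀ j → IsNType d 1 ρ (str j) (λ _ → zero)
      distinct : ∀ j j' → Iso (str j) Full (one zero)
                              (str j') Full (one zero) → j ≡ j'
      complete : ∀ ℓ (A : Struct S ℓ) (c : Fin 1 → Fin ℓ) → IsNType d 1 ρ A c →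
                 ∃ λ j → Iso (str j) Full (one zero)
                             A Full (one (c zero))
  open Reps public

  module _ {d ρ : ℕ} (TT : Reps d ρ) where

    IsNode : ∀ {n} → Struct S n → Fin (N TT) → Fin n → Set
    IsNode U j a = Iso (str TT j) Full (one zero)
                       U (Sphere U ρ (one a)) (one a)

    -- the fixed isomorphisms π_a (as raw maps), required to be isomorphisms
    -- whenever a is a node of the corresponding type
    PiSpec : ∀ {n} → Struct S n → ((j : Fin (N TT)) → Fin n → Fin (suc (size TT j)) → Fin n) → Set
    PiSpec U π = ∀ j a → IsNode U j a →
      IsIso (str TT j) Full (one zero)
            U (Sphere U ρ (one a)) (one a) (π j a)

    -- a factor (B_i , σ_i), with σ_i as a vector of partial values
    Factor : ℕ → Set
    Factor k = Σ (Fin (N TT)) (λ j → Vec (Maybe (Fin (suc (size TT j)))) k)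

    tpart : ∀ {n k} → ((j : Fin (N TT)) → Fin n → Fin (suc (size TT j)) → Fin n) →
            Fin n → Factor k → PTuple k n
    tpart π a (j , σ) p = Maybe.map (π j a) (lookup σ p)

    -- union of pairwise disjoint partial tuples
    ⨆ : ∀ {m k n} → (Fin m → PTuple k n) → PTuple k n
    ⨆ {m} ts p = foldr (λ i acc → ts i p <∣> acc) nothing (allFin m)

    apply : ∀ {m n k} → ((j : Fin (N TT)) → Fin n → Fin (suc (size TT j)) → Fin n) →
            Vec (Factor k) m → Vec (Fin n) m → PTuple k n
    apply π Λ b = ⨆ (λ i → tpart π (lookup b i) (lookup Λ i))

    module _ {k ℓ m : ℕ} (r : ℕ) (B : Struct S ℓ) (cB : Fin k → Fin ℓ)
             (comp : Fin ℓ → Fin m) where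

      Ccon : Fin m → PTuple k ℓ
      Ccon i p = if ⌊ comp (cB p) ≟ i ⌋ then just (cB p) else nothing

      IsMinD : Fin m → Fin k → Set
      IsMinD i p = comp (cB p) ≡ i × (∀ q → comp (cB q) ≡ i → Data.Fin.toℕ p ≤ Data.Fin.toℕ q)

      ConsistentFact : Vec (Factor k) m → Set
      ConsistentFact Λ = ∀ i →
        (∀ p → comp (cB p) ≡ i → ∃ λ x → lookup (proj₂ (lookup Λ i)) p ≡ just x) ×
        (∀ p → comp (cB p) ≢ i → lookup (proj₂ (lookup Λ i)) p ≡ nothing) ×
        (∀ p → IsMinD i p → lookup (proj₂ (lookup Λ i)) p ≡ just zero) ×
        Iso (str TT (proj₁ (lookup Λ i)))
            (Sphere (str TT (proj₁ (lookup Λ i))) r (lookup (proj₂ (lookup Λ i))))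
            (lookup (proj₂ (lookup Λ i)))
            B (λ x → comp x ≡ i) (Ccon i)

      Admissible : ∀ {n} → Struct S n →
                   ((j : Fin (N TT)) → Fin n → Fin (suc (size TT j)) → Fin n) →
                   Vec (Factor k) m → Vec (Fin n) m → Set
      Admissible U π Λ b =
        (∀ i → IsNode U (proj₁ (lookup Λ i)) (lookup b i)) ×
        (∀ i i' → i ≢ i' → DistGt U (2 * r + 1)
                      (tpart π (lookup b i) (lookup Λ i))
                      (tpart π (lookup b i') (lookup Λ i')))

  ComponentLabeling : ∀ {ℓ m} → Struct S ℓ → (Fin ℓ → Fin m) → Set
  ComponentLabeling B comp =
    (∀ x y → comp x ≡ comp y → Connected B x y) ×
    (∀ x y → Connected B x y → comp x ≡ comp y) ×
    (∀ i → ∃ λ x → comp x ≡ i)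

module Submission where

-- Let Cᵢ be a component of 𝓑 and nᵢ the least index of a constant in Cᵢ. Every element of 𝓑 is
-- within r of a constant, so a path in Cᵢ that leaves the r-neighbourhood of the constants within
-- distance s of c_{nᵢ} enters that of a new constant within distance s + 2r + 1. By pigeonhole every
-- constant of Cᵢ is within (2r+1)(k−1) of c_{nᵢ}, and all of Cᵢ within ρ = (2r+1)(k−1) + r.
-- Transported to 𝓤 by the isomorphism 𝒩ᵣ(ā) ≅ 𝓑, the r-neighbourhood of the constants of Cᵢ thus
-- lies in the ρ-ball of bᵢ = a_{nᵢ}. That ball has fewer than d^{ρ+1} elements, so bᵢ is a
-- 𝓑ᵢ-node for a unique 𝓑ᵢ ∈ 𝒯_ρ, and σᵢ = π_{bᵢ}⁻¹ ∘ ā on Dᵢ gives the factorization.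
-- Admissibility: a path of length ≤ 2r+1 between constants stays in 𝒩ᵣ(ā), so it pulls back to 𝓑
-- and the constants share a component. Uniqueness: σᵢ(nᵢ) = 1 forces bᵢ = a_{nᵢ}, the type of bᵢ
-- is unique, and σᵢ is determined by t_{bᵢ,σᵢ} because π_{bᵢ} is injective.

open import Defs
open import Data.Bool using (Bool; true; not; _∧_; _∨_; T; if_then_else_)
open import Data.Bool.ListAction using (or)
open import Data.Bool.Properties using (∨-comm)
open import Data.Empty using (⊥-elim)
open import Data.Fin using (Fin; zero; suc; toℕ; fromℕ<; _≟_)
open import Data.Fin.Properties
  using (any?; suc-injective; injective⇒≤; toℕ-injective; toℕ-inject; toℕ-fromℕ<; ¬∀⟶∃¬-smallest)
open import Data.List using (List; []; _∷_; allFin; filter; foldr; length)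
import Data.List as List using (map; tabulate; lookup)
import Data.List.Properties as Listₚ
open import Data.List.Membership.Propositional using (_∈_)
open import Data.List.Membership.Propositional.Properties using (∈-filter⁺; ∈-filter⁻; ∈-allFin; ∈-lookup)
open import Data.List.Relation.Unary.AllPairs using (_∷_)
import Data.List.Relation.Unary.All as All
open import Data.List.Relation.Unary.Any using (here; there)
import Data.List.Relation.Unary.Any as Any
open import Data.List.Relation.Unary.Any.Properties using (lookup-index)
open import Data.List.Relation.Unary.Unique.Propositional using (Unique)
open import Data.List.Relation.Unary.Unique.Propositional.Properties using (filter⁺; allFin⁺)
open import Data.Maybe using (Maybe; just; nothing; _<∣>_)
import Data.Maybe as Maybe
import Data.Maybe.Properties as Maybeₚ
open import Data.Nat using (ℕ; zero; suc; _+_; _*_; _∸_; _^_; _≤_; _≤?_; z≤n; s≤s)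
open import Data.Nat.ListAction using () renaming (sum to sumList)
open import Data.Nat.Properties
  using ( +-*-semiring; +-comm; +-suc; *-comm; *-identityˡ; *-identityʳ; m+n∸n≡m
        ; ≤-refl; ≤-trans; ≤-antisym; ≤-reflexive; <-irrefl; ≰⇒>; ≮⇒≥; m≤m+n; m≤n+m; n≤1+n
        ; +-mono-≤; +-monoˡ-≤; +-monoʳ-≤; *-monoʳ-≤; module ≤-Reasoning)
open import Data.Nat.Tactic.RingSolver using (solve-∀)
open import Algebra.Properties.Semiring.Sum +-*-semiring
  using (sum-syntax; sum-cong-≗; sum-replicate-zero; ∑-distrib-+; ∑-comm; *-distribˡ-sum)
open import Data.Product using (Σ; ∃; ∃₂; _×_; _,_; proj₁; proj₂)
open import Data.Sum using (_⊎_; inj₁; inj₂; [_,_]′)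
import Data.Sum
open import Data.Unit using (tt)
open import Data.Vec using (Vec; lookup; tabulate)
open import Data.Vec.Properties using (tabulate∘lookup; tabulate-cong; lookup∘tabulate)
import Data.Vec.Functional as Vector
open import Function using (_∘_; id; mk⇔)
open import Function.Bundles using (_⇔_; module Equivalence)
open import Function.Definitions using (Injective)
open import Relation.Binary.PropositionalEquality
open import Relation.Nullary using (¬_; Dec; yes; no; _×-dec_; contradiction)
open import Relation.Nullary.Decidable
  using (⌊_⌋; T?; ¬?; map′; toSum; decidable-stable; dec-true; dec-false; ⌊⌋-map′; does-⇔; isYes≗does)

⌊⌋-⇔ : ∀ {A B : Set} → A ⇔ B → (a? : Dec A) (b? : Dec B) → ⌊ a? ⌋ ≡ ⌊ b? ⌋
⌊⌋-⇔ A⇔B a? b? = trans (isYes≗does a?) (trans (does-⇔ A⇔B a? b?) (sym (isYes≗does b?)))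

-- deg in Defs counts neighbours with this indicator, so deg A x unfolds to a sum of 𝟙 (adjB A x y).
𝟙 : Bool → ℕ
𝟙 b = if b then 1 else 0

𝟙-yes : ∀ {P : Set} (P? : Dec P) → P → 𝟙 ⌊ P? ⌋ ≡ 1
𝟙-yes (yes _) _  = refl
𝟙-yes (no ¬p) p  = ⊥-elim (¬p p)

T⇒𝟙 : ∀ {b} → T b → 𝟙 b ≡ 1
T⇒𝟙 {true} _ = refl

sumList-tabulate : ∀ {n} (g : Fin n → ℕ) → sumList (List.tabulate g) ≡ ∑[ i < n ] g i
sumList-tabulate {zero}  g = refl
sumList-tabulate {suc n} g = cong (g zero +_) (sumList-tabulate (g ∘ suc))

sumList-allFin : ∀ {n} (g : Fin n → ℕ) → sumList (List.map g (allFin n)) ≡ ∑[ i < n ] g i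
sumList-allFin g = trans (cong sumList (Listₚ.map-tabulate id g)) (sumList-tabulate g)

length-filter≡sum : ∀ {A : Set} {P : A → Set} (P? : ∀ x → Dec (P x)) xs →
                    length (filter P? xs) ≡ sumList (List.map (𝟙 ∘ ⌊_⌋ ∘ P?) xs)
length-filter≡sum P? []       = refl
length-filter≡sum P? (x ∷ xs) with P? x
... | yes _ = cong suc (length-filter≡sum P? xs)
... | no  _ = length-filter≡sum P? xs

sumList-filter-≤ : ∀ {A : Set} {P : A → Set} (P? : ∀ x → Dec (P x)) (g : A → ℕ) xs →
                   sumList (List.map g (filter P? xs)) ≤ sumList (List.map g xs)
sumList-filter-≤ P? g []       = z≤n
sumList-filter-≤ P? g (x ∷ xs) with P? x
... | yes _ = +-monoʳ-≤ (g x) (sumList-filter-≤ P? g xs)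
... | no  _ = ≤-trans (sumList-filter-≤ P? g xs) (m≤n+m _ (g x))

∑-mono-≤ : ∀ {n} {f g : Fin n → ℕ} → (∀ i → f i ≤ g i) → ∑[ i < n ] f i ≤ ∑[ i < n ] g i
∑-mono-≤ {zero}  f≤g = z≤n
∑-mono-≤ {suc n} f≤g = +-mono-≤ (f≤g zero) (∑-mono-≤ (f≤g ∘ suc))

term≤∑ : ∀ {n} (f : Fin n → ℕ) i → f i ≤ ∑[ j < n ] f j
term≤∑ f zero    = m≤m+n _ _
term≤∑ f (suc i) = ≤-trans (term≤∑ (f ∘ suc) i) (m≤n+m _ (f zero))

∑-δ : ∀ {n} (b : Fin n) → ∑[ z < n ] 𝟙 ⌊ z ≟ b ⌋ ≡ 1
∑-δ {suc n} zero    = cong suc (sum-replicate-zero n)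
∑-δ {suc n} (suc b) = trans (sum-cong-≗ (λ z → cong 𝟙 (⌊⌋-map′ (cong suc) suc-injective (z ≟ b)))) (∑-δ b)

lookup-injective : ∀ {A : Set} {xs : List A} → Unique xs →
                   ∀ i j → List.lookup xs i ≡ List.lookup xs j → i ≡ j
lookup-injective (_ ∷ _)    zero    zero    _ = refl
lookup-injective (x∉ ∷ _)   zero    (suc j) e = ⊥-elim (All.lookup x∉ (∈-lookup j) e)
lookup-injective (x∉ ∷ _)   (suc i) zero    e = ⊥-elim (All.lookup x∉ (∈-lookup i) (sym e))
lookup-injective (_ ∷ uniq) (suc i) (suc j) e = cong suc (lookup-injective uniq i j e)

map-lookup-allFin : ∀ {A : Set} (xs : List A) → List.map (List.lookup xs) (allFin (length xs)) ≡ xs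
map-lookup-allFin xs = trans (Listₚ.map-tabulate id (List.lookup xs)) (Listₚ.tabulate-lookup xs)

∷-injective : ∀ {m n} {x : Fin n} {f : Fin m → Fin n} →
              Injective _≡_ _≡_ f → (∀ i → f i ≢ x) → Injective _≡_ _≡_ (x Vector.∷ f)
∷-injective f-inj x∉f {zero}  {zero}  _ = refl
∷-injective f-inj x∉f {zero}  {suc j} e = ⊥-elim (x∉f j (sym e))
∷-injective f-inj x∉f {suc i} {zero}  e = ⊥-elim (x∉f i e)
∷-injective f-inj x∉f {suc i} {suc j} e = cong suc (f-inj e)

least-witness : ∀ {k} {P : Fin k → Set} → (∀ q → Dec (P q)) → ∃ P →
                ∃ λ p → P p × ∀ q → P q → toℕ p ≤ toℕ q
least-witness {k} {P} P? (q , Pq) with ¬∀⟶∃¬-smallest k (¬_ ∘ P) (¬? ∘ P?) (λ none → none q Pq)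
... | p , ¬¬Pp , below = p , decidable-stable (P? p) ¬¬Pp , λ q′ Pq′ → ≮⇒≥ λ q′<p →
  below (fromℕ< q′<p) (subst P (sym (toℕ-injective (trans (toℕ-inject _) (toℕ-fromℕ< q′<p)))) Pq′)

Vec-ext : ∀ {A : Set} {k} {u v : Vec A k} → (∀ p → lookup u p ≡ lookup v p) → u ≡ v
Vec-ext {u = u} {v} u≗v = trans (sym (tabulate∘lookup u)) (trans (tabulate-cong u≗v) (tabulate∘lookup v))

map-inverseˡ : ∀ {A B : Set} {f : A → B} {g : B → A} → (∀ x → g (f x) ≡ x) →
               ∀ mx → Maybe.map g (Maybe.map f mx) ≡ mx
map-inverseˡ g∘f≗id nothing  = refl
map-inverseˡ g∘f≗id (just x) = cong just (g∘f≗id x)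

foldr-<∣>-≡ : ∀ {I X : Set} (ts : I → Maybe X) {v} → (∀ i → ts i ≡ nothing ⊎ ts i ≡ v) →
              ∀ {i₀ is} → i₀ ∈ is → ts i₀ ≡ v → foldr (λ i acc → ts i <∣> acc) nothing is ≡ v
foldr-<∣>-≡ ts {nothing} alternatives {is = is} _ _ = all-nothing is
  where
  all-nothing : ∀ is → foldr (λ i acc → ts i <∣> acc) nothing is ≡ nothing
  all-nothing []       = refl
  all-nothing (i ∷ is) rewrite [ id , id ]′ (alternatives i) = all-nothing is
foldr-<∣>-≡ ts {just _} alternatives (here refl) e rewrite e = refl
foldr-<∣>-≡ ts {just _} alternatives {is = i ∷ _} (there i₀∈) e with alternatives i
... | inj₁ tsi≡nothing rewrite tsi≡nothing = foldr-<∣>-≡ ts alternatives i₀∈ e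
... | inj₂ tsi≡v       rewrite tsi≡v       = refl

-- Distance in the Gaifman graph

module _ {S : Sig} where
  open Sig S

  adjB-sym : ∀ {n} (A : Struct S n) x y → adjB A x y ≡ adjB A y x
  adjB-sym A x y = cong₂ _∧_
    (cong not (⌊⌋-⇔ (mk⇔ sym sym) (x ≟ y) (y ≟ x)))
    (cong or (Listₚ.map-cong (λ R → ∨-comm (bin A R x y) _) (allFin nB)))

  Adj-sym : ∀ {n} (A : Struct S n) {x y} → Adj A x y → Adj A y x
  Adj-sym A {x} {y} = subst T (adjB-sym A x y)

  Adj? : ∀ {n} (A : Struct S n) x y → Dec (Adj A x y)
  Adj? A x y = T? (adjB A x y)

  adjB-transport : ∀ {n n'} (A : Struct S n) (A' : Struct S n') (f : Fin n → Fin n') {x y} →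
    (f x ≡ f y → x ≡ y) →
    (∀ R → bin A R x y ≡ bin A' R (f x) (f y)) → (∀ R → bin A R y x ≡ bin A' R (f y) (f x)) →
    adjB A x y ≡ adjB A' (f x) (f y)
  adjB-transport A A' f {x} {y} inj xy yx = cong₂ _∧_
    (cong not (⌊⌋-⇔ (mk⇔ (cong f) inj) (x ≟ y) (f x ≟ f y)))
    (cong or (Listₚ.map-cong (λ R → cong₂ _∨_ (xy R) (yx R)) (allFin nB)))

  module _ {n} {A : Struct S n} where

    Within-mono : ∀ {r s x y} → r ≤ s → Within A r x y → Within A s x y
    Within-mono _         here       = here
    Within-mono (s≤s r≤s) (step a w) = step a (Within-mono r≤s w)

    Within-trans : ∀ {r s x y z} → Within A r x y → Within A s y z → Within A (r + s) x z
    Within-trans {r} {s} here w′ = Within-mono (m≤n+m s r) w′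
    Within-trans (step a w) w′ = step a (Within-trans w w′)

    Within-snoc : ∀ {r x y z} → Within A r x y → Adj A y z → Within A (suc r) x z
    Within-snoc here       a = step a here
    Within-snoc (step a w) b = step a (Within-snoc w b)

    Within-sym : ∀ {r x y} → Within A r x y → Within A r y x
    Within-sym here       = here
    Within-sym (step a w) = Within-snoc (Within-sym w) (Adj-sym A a)

    Within? : ∀ r x y → Dec (Within A r x y)
    Within? r x y with x ≟ y
    ... | yes refl = yes here
    Within? zero x y | no x≢y = no λ { here → x≢y refl }
    Within? (suc r) x y | no x≢y =
      map′ (λ (z , a , w) → step a w) from (any? λ z → Adj? A x z ×-dec Within? r z y)
      where
      from : Within A (suc r) x y → ∃ λ z → Adj A x z × Within A r z y
      from here       = ⊥-elim (x≢y refl)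
      from (step a w) = _ , a , w

    Sphere? : ∀ {k} r (t : PTuple k n) x → Dec (Sphere A r t x)
    Sphere? r t x = any? (λ j → around (t j))
      where
      around : (c : Maybe (Fin n)) → Dec (∃ λ y → c ≡ just y × Within A r y x)
      around nothing  = no λ ()
      around (just y) = map′ (λ w → y , refl , w) (λ { (_ , refl , w) → w }) (Within? r y x)

    Within-split : ∀ r {t u x y z} → t + u ≤ 2 * r + 1 → Within A t x z → Within A u z y →
                   Within A r x z ⊎ Within A r y z
    Within-split r {t} {u} t+u≤ w w′ with t ≤? r | u ≤? r
    ... | yes t≤r | _       = inj₁ (Within-mono t≤r w)
    ... | no _    | yes u≤r = inj₂ (Within-mono u≤r (Within-sym w′))
    ... | no t≰r  | no u≰r  = ⊥-elim (<-irrefl refl (begin-strict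
      2 * r + 1       <⟨ ≤-reflexive (2r+2≡ r) ⟩
      suc r + suc r   ≤⟨ +-mono-≤ (≰⇒> t≰r) (≰⇒> u≰r) ⟩
      t + u           ≤⟨ t+u≤ ⟩
      2 * r + 1       ∎))
      where
      open ≤-Reasoning
      2r+2≡ : ∀ r → suc (2 * r + 1) ≡ suc r + suc r
      2r+2≡ = solve-∀

  -- P has to contain every z with d(x,z) + d(z,y) ≤ s, in particular every vertex of the path.
  Within-transport : ∀ {n n'} {A : Struct S n} {A' : Struct S n'} (P : Fin n → Set) (g : Fin n → Fin n') →
    (∀ {u v} → P u → P v → Adj A u v → Adj A' (g u) (g v)) →
    ∀ {s x y} → (∀ {z t u} → t + u ≤ s → Within A t x z → Within A u z y → P z) →
    Within A s x y → Within A' s (g x) (g y)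
  Within-transport P g adj onPath here = here
  Within-transport P g adj onPath (step a w) =
    step (adj (onPath ≤-refl (here {r = 0}) (step a w)) (onPath ≤-refl (step a (here {r = 0})) w) a)
         (Within-transport P g adj (λ t+u≤s w₁ w₂ → onPath (s≤s t+u≤s) (step a w₁) w₂) w)

  Within-map : ∀ {n n'} {A : Struct S n} {A' : Struct S n'} (g : Fin n → Fin n') →
    (∀ {u v} → Adj A u v → Adj A' (g u) (g v)) →
    ∀ {s x y} → Within A s x y → Within A' s (g x) (g y)
  Within-map g adj = Within-transport Full g (λ _ _ → adj) _

  -- Isomorphisms of induced substructures

  module _ {k n n'} {A : Struct S n} {P : Fin n → Set} {c : PTuple k n}
           {A' : Struct S n'} {P' : Fin n' → Set} {c' : PTuple k n'} {f : Fin n → Fin n'}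
           (I : IsIso A P c A' P' c' f) where
    open IsIso I

    IsIso-Adj : ∀ {u v} → P u → P v → Adj A u v → Adj A' (f u) (f v)
    IsIso-Adj pu pv = subst T (adjB-transport A A' f (inj _ _ pu pv)
                                (λ R → bin-pres R _ _ pu pv) (λ R → bin-pres R _ _ pv pu))

    IsIso-restrict : ∀ {k′} {Q : Fin n → Set} {Q' : Fin n' → Set} {d : PTuple k′ n} {d' : PTuple k′ n'} →
      (∀ {x} → Q x → P x) → (∀ {x} → Q x → Q' (f x)) → (∀ {y} → Q' y → ∃ λ x → Q x × f x ≡ y) →
      (∀ j → Maybe.map f (d j) ≡ d' j) → IsIso A Q d A' Q' d' f
    IsIso-restrict Q⊆P into′ surj′ con-pres′ = record
      { into     = λ _ → into′
      ; inj      = λ x y qx qy → inj x y (Q⊆P qx) (Q⊆P qy)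
      ; surj     = λ _ → surj′
      ; nul-pres = nul-pres
      ; un-pres  = λ R x qx → un-pres R x (Q⊆P qx)
      ; bin-pres = λ R x y qx qy → bin-pres R x y (Q⊆P qx) (Q⊆P qy)
      ; con-pres = con-pres′
      }

  IsIso-∘ : ∀ {k n₁ n₂ n₃} {A₁ : Struct S n₁} {P₁ : Fin n₁ → Set} {c₁ : PTuple k n₁}
    {A₂ : Struct S n₂} {P₂ : Fin n₂ → Set} {c₂ : PTuple k n₂}
    {A₃ : Struct S n₃} {P₃ : Fin n₃ → Set} {c₃ : PTuple k n₃} {f g} →
    IsIso A₁ P₁ c₁ A₂ P₂ c₂ f → IsIso A₂ P₂ c₂ A₃ P₃ c₃ g →
    IsIso A₁ P₁ c₁ A₃ P₃ c₃ (g ∘ f)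
  IsIso-∘ {c₁ = c₁} {f = f} {g} I J = record
    { into     = λ x px → J.into (f x) (I.into x px)
    ; inj      = λ x y px py e → I.inj x y px py (J.inj _ _ (I.into x px) (I.into y py) e)
    ; surj     = surj
    ; nul-pres = λ R → trans (I.nul-pres R) (J.nul-pres R)
    ; un-pres  = λ R x px → trans (I.un-pres R x px) (J.un-pres R (f x) (I.into x px))
    ; bin-pres = λ R x y px py →
        trans (I.bin-pres R x y px py) (J.bin-pres R _ _ (I.into x px) (I.into y py))
    ; con-pres = λ j → trans (Maybeₚ.map-∘ (c₁ j)) (trans (cong (Maybe.map g) (I.con-pres j)) (J.con-pres j))
    }
    where
    module I = IsIso I
    module J = IsIso J
    surj : ∀ z → _ → ∃ λ x → _ × g (f x) ≡ z
    surj z pz with J.surj z pz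
    ... | y , py , gy≡z with I.surj y py
    ...   | x , px , fx≡y = x , px , trans (cong g fx≡y) gy≡z

  module Inverse {k n n'} {A : Struct S n} {c : PTuple k n}
                 {A' : Struct S n'} {P' : Fin n' → Set} {c' : PTuple k n'} {f : Fin n → Fin n'}
                 (I : IsIso A Full c A' P' c' f) (P'? : ∀ y → Dec (P' y)) (x₀ : Fin n) where
    open IsIso I

    -- x₀ is the junk value outside P'.
    inverse : Fin n' → Fin n
    inverse y with P'? y
    ... | yes py = proj₁ (surj y py)
    ... | no _   = x₀

    f-inverse : ∀ {y} → P' y → f (inverse y) ≡ y
    f-inverse {y} py with P'? y
    ... | yes py′ = proj₂ (proj₂ (surj y py′))
    ... | no ¬py  = ⊥-elim (¬py py)

    inverse-f : ∀ x → inverse (f x) ≡ x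
    inverse-f x = inj _ _ tt tt (f-inverse (into x tt))

    inverse-isIso : IsIso A' P' c' A Full c inverse
    inverse-isIso = record
      { into     = _
      ; inj      = λ x y px py e → trans (sym (f-inverse px)) (trans (cong f e) (f-inverse py))
      ; surj     = λ x _ → f x , into x tt , inverse-f x
      ; nul-pres = λ R → sym (nul-pres R)
      ; un-pres  = λ R y py → trans (cong (un A' R) (sym (f-inverse py))) (sym (un-pres R _ tt))
      ; bin-pres = λ R x y px py →
          trans (cong₂ (bin A' R) (sym (f-inverse px)) (sym (f-inverse py))) (sym (bin-pres R _ _ tt tt))
      ; con-pres = λ j → trans (cong (Maybe.map inverse) (sym (con-pres j))) (map-inverseˡ inverse-f (c j))
      }

  -- Balls are neighbourhood types

  module BallSize {n} (U : Struct S n) {d} (bounded : Bounded d U) (b : Fin n) where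

    ballSize : ℕ → ℕ
    ballSize s = ∑[ z < n ] 𝟙 ⌊ Within? {A = U} s b z ⌋

    ballSize-zero : ballSize 0 ≤ 1
    ballSize-zero = ≤-trans (∑-mono-≤ centre-only) (≤-reflexive (∑-δ b))
      where
      centre-only : ∀ z → 𝟙 ⌊ Within? {A = U} 0 b z ⌋ ≤ 𝟙 ⌊ z ≟ b ⌋
      centre-only z with Within? {A = U} 0 b z
      ... | yes here = ≤-reflexive (sym (𝟙-yes (z ≟ b) refl))
      ... | no _     = z≤n

    ballSize-suc : ∀ s → ballSize (suc s) ≤ 1 + d * ballSize s
    ballSize-suc s = begin
      ballSize (suc s)                                       ≤⟨ ∑-mono-≤ centre-or-neighbour ⟩
      ∑[ z < n ] (δ z + ∑[ y < n ] (β y * α y z))            ≡⟨ ∑-distrib-+ δ _ ⟩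
      ∑[ z < n ] δ z + ∑[ z < n ] ∑[ y < n ] (β y * α y z)   ≡⟨ cong₂ _+_ (∑-δ b) (∑-comm (λ z y → β y * α y z)) ⟩
      1 + ∑[ y < n ] ∑[ z < n ] (β y * α y z)                ≡⟨ cong (1 +_) (sum-cong-≗ β*deg) ⟨
      1 + ∑[ y < n ] (β y * deg U y)                         ≤⟨ +-monoʳ-≤ 1 (∑-mono-≤ λ y → *-monoʳ-≤ (β y) (bounded y)) ⟩
      1 + ∑[ y < n ] (β y * d)                               ≡⟨ cong (1 +_) (sum-cong-≗ λ y → *-comm (β y) d) ⟩
      1 + ∑[ y < n ] (d * β y)                               ≡⟨ cong (1 +_) (*-distribˡ-sum d β) ⟨
      1 + d * ballSize s                                     ∎
      where
      open ≤-Reasoning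
      δ : Fin n → ℕ
      δ z = 𝟙 ⌊ z ≟ b ⌋
      β : Fin n → ℕ
      β y = 𝟙 ⌊ Within? {A = U} s b y ⌋
      α : Fin n → Fin n → ℕ
      α y z = 𝟙 (adjB U y z)

      β*deg : ∀ y → β y * deg U y ≡ ∑[ z < n ] (β y * α y z)
      β*deg y = trans (cong (β y *_) (sumList-allFin (α y))) (*-distribˡ-sum (β y) (α y))

      centre-or-neighbour : ∀ z → 𝟙 ⌊ Within? {A = U} (suc s) b z ⌋ ≤ δ z + ∑[ y < n ] (β y * α y z)
      centre-or-neighbour z with Within? {A = U} (suc s) b z
      ... | no _  = z≤n
      ... | yes w with Within-sym w
      ...   | here = ≤-trans (≤-reflexive (sym (𝟙-yes (z ≟ b) refl))) (m≤m+n _ _)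
      ...   | step {y = y} z~y y~b =
        ≤-trans (≤-reflexive (sym β*α≡1)) (≤-trans (term≤∑ (λ y → β y * α y z) y) (m≤n+m _ _))
        where
        β*α≡1 : β y * α y z ≡ 1
        β*α≡1 = cong₂ _*_ (𝟙-yes (Within? {A = U} s b y) (Within-sym y~b)) (T⇒𝟙 (Adj-sym U z~y))

    ballSize-bound : 2 ≤ d → ∀ s → ballSize s + 1 ≤ d ^ suc s
    ballSize-bound 2≤d zero = begin
      ballSize 0 + 1   ≤⟨ +-monoˡ-≤ 1 ballSize-zero ⟩
      2                ≤⟨ 2≤d ⟩
      d                ≡⟨ *-identityʳ d ⟨
      d ^ 1            ∎
      where open ≤-Reasoning
    ballSize-bound 2≤d (suc s) = begin
      ballSize (suc s) + 1      ≤⟨ +-monoˡ-≤ 1 (ballSize-suc s) ⟩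
      1 + d * ballSize s + 1    ≡⟨ +-comm (1 + d * ballSize s) 1 ⟩
      2 + d * ballSize s        ≤⟨ +-monoˡ-≤ (d * ballSize s) 2≤d ⟩
      d + d * ballSize s        ≡⟨ d+d*c≡ d (ballSize s) ⟩
      d * (ballSize s + 1)      ≤⟨ *-monoʳ-≤ d (ballSize-bound 2≤d s) ⟩
      d ^ suc (suc s)           ∎
      where
      open ≤-Reasoning
      d+d*c≡ : ∀ d c → d + d * c ≡ d * (c + 1)
      d+d*c≡ = solve-∀

  module Induced {n} (U : Struct S n) {P : Fin n → Set} (P? : ∀ x → Dec (P x)) where

    members : List (Fin n)
    members = filter P? (allFin n)

    card : ℕ
    card = length members

    embed : Fin card → Fin n
    embed = List.lookup members

    structure : Struct S card
    structure = record
      { nul = nul U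
      ; un  = λ R x → un U R (embed x)
      ; bin = λ R x y → bin U R (embed x) (embed y)
      }

    embed-injective : ∀ x y → embed x ≡ embed y → x ≡ y
    embed-injective = lookup-injective (filter⁺ P? (allFin⁺ n))

    embed-∈ : ∀ x → P (embed x)
    embed-∈ x = proj₂ (∈-filter⁻ P? {xs = allFin n} (∈-lookup x))

    index : ∀ {y} → P y → Fin card
    index {y} py = Any.index (∈-filter⁺ P? (∈-allFin y) py)

    embed-index : ∀ {y} (py : P y) → embed (index py) ≡ y
    embed-index {y} py = sym (lookup-index (∈-filter⁺ P? (∈-allFin y) py))

    embed-isIso : ∀ {k} {c : PTuple k card} {c' : PTuple k n} →
                  (∀ j → Maybe.map embed (c j) ≡ c' j) → IsIso structure Full c U P c' embed
    embed-isIso con-pres = record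
      { into     = λ x _ → embed-∈ x
      ; inj      = λ x y _ _ → embed-injective x y
      ; surj     = λ y py → index py , tt , embed-index py
      ; nul-pres = λ _ → refl
      ; un-pres  = λ _ _ _ → refl
      ; bin-pres = λ _ _ _ _ _ → refl
      ; con-pres = con-pres
      }

    card≡∑ : card ≡ ∑[ y < n ] 𝟙 ⌊ P? y ⌋
    card≡∑ = trans (length-filter≡sum P? (allFin n)) (sumList-allFin (𝟙 ∘ ⌊_⌋ ∘ P?))

    deg-structure≤ : ∀ x → deg structure x ≤ deg U (embed x)
    deg-structure≤ x = begin
      sumList (List.map (𝟙 ∘ adjB structure x) (allFin card))      ≡⟨ cong sumList (Listₚ.map-cong adj≡ (allFin card)) ⟩
      sumList (List.map (g ∘ embed) (allFin card))                  ≡⟨ cong sumList (Listₚ.map-∘ (allFin card)) ⟩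
      sumList (List.map g (List.map embed (allFin card)))           ≡⟨ cong (sumList ∘ List.map g) (map-lookup-allFin members) ⟩
      sumList (List.map g members)                                  ≤⟨ sumList-filter-≤ P? g (allFin n) ⟩
      sumList (List.map g (allFin n))                               ∎
      where
      open ≤-Reasoning
      g : Fin n → ℕ
      g = 𝟙 ∘ adjB U (embed x)
      adj≡ : ∀ y → 𝟙 (adjB structure x y) ≡ g (embed y)
      adj≡ y = cong 𝟙 (adjB-transport structure U embed (embed-injective x y) (λ _ → refl) (λ _ → refl))

  module Ball {n} (U : Struct S n) (ρ : ℕ) (b : Fin n) where

    sphere⇔within : ∀ {z} → Sphere U ρ (one b) z ⇔ Within U ρ b z
    sphere⇔within = mk⇔ (λ { (_ , _ , refl , w) → w }) (λ w → zero , b , refl , w)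

    open Induced U (Sphere? {A = U} ρ (one b)) public

    centre : Fin card
    centre = index (Equivalence.from sphere⇔within here)

    ball-iso : IsIso structure Full (one centre) U (Sphere U ρ (one b)) (one b) embed
    ball-iso = embed-isIso (λ _ → cong just (embed-index _))

    ball-covered : ∀ x → Within structure ρ centre x
    ball-covered x = subst₂ (Within structure ρ) inverse-b≡centre (inverse-f x)
      (Within-transport (Sphere U ρ (one b)) inverse (IsIso-Adj inverse-isIso)
        (λ t+u≤ρ w _ → Equivalence.from sphere⇔within (Within-mono (≤-trans (m≤m+n _ _) t+u≤ρ) w))
        (Equivalence.to sphere⇔within (embed-∈ x)))
      where
      open Inverse ball-iso (Sphere? ρ (one b)) centre
      inverse-b≡centre : inverse b ≡ centre
      inverse-b≡centre = trans (cong inverse (sym (embed-index _))) (inverse-f centre)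

    ball-isNType : ∀ {d} → 2 ≤ d → Bounded d U → IsNType d 1 ρ structure (λ _ → centre)
    ball-isNType {d} 2≤d bounded = bounded-structure , card-bound , λ x → zero , ball-covered x
      where
      open BallSize U bounded b
      bounded-structure : Bounded d structure
      bounded-structure x = ≤-trans (deg-structure≤ x) (bounded (embed x))
      card-bound : card ≤ 1 * d ^ suc ρ
      card-bound = begin
        card                                         ≡⟨ card≡∑ ⟩
        ∑[ z < n ] 𝟙 ⌊ Sphere? {A = U} ρ (one b) z ⌋  ≡⟨ sum-cong-≗ {n} (λ z → cong 𝟙 (⌊⌋-⇔ sphere⇔within _ _)) ⟩
        ballSize ρ                                   ≤⟨ m≤m+n _ 1 ⟩
        ballSize ρ + 1                               ≤⟨ ballSize-bound 2≤d ρ ⟩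
        d ^ suc ρ                                    ≡⟨ *-identityˡ _ ⟨
        1 * d ^ suc ρ                                ∎
        where open ≤-Reasoning

  node-type-exists : ∀ {d ρ} (TT : Reps d ρ) {n} {U : Struct S n} → 2 ≤ d → Bounded d U →
                     ∀ b → ∃ λ j → IsNode TT U j b
  node-type-exists TT {U = U} 2≤d bounded b =
    let j , _ , I = complete TT _ structure _ (ball-isNType 2≤d bounded) in j , _ , IsIso-∘ I ball-iso
    where open Ball U _ b

  -- Constants of one component are close to each other

  module ConstantsClose {ℓ k′} {B : Struct S ℓ} (r : ℕ) (c : Fin (suc k′) → Fin ℓ)
                        (cover : ∀ x → ∃ λ q → Within B r (c q) x) (p : Fin (suc k′)) where

    Reached : ℕ → Fin (suc k′) → Set
    Reached s q = Within B ((2 * r + 1) * s) (c p) (c q)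

    Near : ℕ → Fin ℓ → Set
    Near s z = ∃ λ q → Reached s q × Within B r (c q) z

    Near? : ∀ s z → Dec (Near s z)
    Near? s z = any? λ q → Within? _ (c p) (c q) ×-dec Within? r (c q) z

    crossing : ∀ s {t u v} → Within B t u v → Near s u → ¬ Near s v →
               ∃₂ λ z z′ → Near s z × ¬ Near s z′ × Adj B z z′
    crossing s here               near ¬near = ⊥-elim (¬near near)
    crossing s (step {y = y} a w) near ¬near with Near? s y
    ... | yes near-y = crossing s w near-y ¬near
    ... | no ¬near-y = _ , y , near , ¬near-y , a

    round-length : ∀ s → (2 * r + 1) * s + (r + suc r) ≡ (2 * r + 1) * suc s
    round-length = eq r
      where
      eq : ∀ r s → (2 * r + 1) * s + (r + suc r) ≡ (2 * r + 1) * suc s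
      eq = solve-∀

    half-round-fits : ∀ s → (2 * r + 1) * s + r ≤ (2 * r + 1) * suc s
    half-round-fits s = ≤-trans (+-monoʳ-≤ _ (m≤m+n r (suc r))) (≤-reflexive (round-length s))

    -- The path from c p to c q leaves the r-neighbourhood of the reached constants along an edge,
    -- and the far end of that edge is within r of a constant reached one round later.
    next-reached : ∀ s q → Connected B (c p) (c q) → ¬ Reached s q →
                   ∃ λ q′ → ¬ Reached s q′ × Reached (suc s) q′
    next-reached s q (_ , path) ¬reached with Near? s (c q)
    ... | yes (q₀ , r₀ , w₀) =
      q , ¬reached , Within-mono (half-round-fits s) (Within-trans r₀ w₀)
    ... | no ¬near with crossing s path (p , here , here) ¬near
    ...   | z , z′ , (q₀ , r₀ , w₀) , ¬near-z′ , a with cover z′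
    ...     | q′ , w′ = q′ , (λ reached → ¬near-z′ (q′ , reached , w′)) ,
                        subst (λ t → Within B t (c p) (c q′)) (round-length s)
                          (Within-trans r₀ (Within-trans w₀ (step a (Within-sym w′))))

    Reached-suc : ∀ {s q} → Reached s q → Reached (suc s) q
    Reached-suc {s} = Within-mono (*-monoʳ-≤ (2 * r + 1) (n≤1+n s))

    unreached-∉ : ∀ {s m q} {f : Fin m → Fin (suc k′)} → (∀ i → Reached s (f i)) → ¬ Reached s q →
                  ∀ i → f i ≢ q
    unreached-∉ f-reached ¬reached i e = ¬reached (subst (Reached _) e (f-reached i))

    -- Every round reaches a new constant until q is reached, and there are only k′ + 1 constants.
    reached-or-many : ∀ q → Connected B (c p) (c q) → ∀ s →
      Reached s q ⊎ (¬ Reached s q × Σ (Fin (suc s) → Fin (suc k′)) λ f →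
                                        Injective _≡_ _≡_ f × ∀ i → Reached s (f i))
    reached-or-many q conn zero with Within? _ (c p) (c q)
    ... | yes reached = inj₁ reached
    ... | no ¬reached = inj₂ (¬reached , (λ _ → p) , (λ { {zero} {zero} _ → refl }) , λ _ → here)
    reached-or-many q conn (suc s) with reached-or-many q conn s | Within? _ (c p) (c q)
    ... | inj₁ reached | _           = inj₁ (Reached-suc reached)
    ... | inj₂ _       | yes reached = inj₁ reached
    ... | inj₂ (¬reached , f , f-inj , f-reached) | no ¬reached′ with next-reached s q conn ¬reached
    ...   | q′ , ¬reached-q′ , reached-q′ =
      inj₂ (¬reached′ , q′ Vector.∷ f ,
            ∷-injective f-inj (unreached-∉ f-reached ¬reached-q′) ,
            λ { zero → reached-q′ ; (suc i) → Reached-suc (f-reached i) })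

    constants-close : ∀ q → Connected B (c p) (c q) → Within B ((2 * r + 1) * k′) (c p) (c q)
    constants-close q conn with reached-or-many q conn k′
    ... | inj₁ reached = reached
    ... | inj₂ (¬reached , f , f-inj , f-reached) =
      ⊥-elim (<-irrefl refl (injective⇒≤ (∷-injective f-inj (unreached-∉ f-reached ¬reached))))

  -- Factorization of a neighbourhood type

  module Factorization
    {d ρ} (TT : Reps d ρ) {n} {U : Struct S n}
    (π : (j : Fin (N TT)) → Fin n → Fin (suc (size TT j)) → Fin n) (π-iso : PiSpec TT U π)
    (node-type : ∀ b → ∃ λ j → IsNode TT U j b)
    {r k′} (ρ-large : (2 * r + 1) * k′ + r ≤ ρ)
    {ℓ} {B : Struct S ℓ} {cB : Fin (suc k′) → Fin ℓ} (cover : ∀ x → ∃ λ q → Within B r (cB q) x)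
    {m} {comp : Fin ℓ → Fin m} (labelling : ComponentLabeling B comp)
    {a : Fin (suc k′) → Fin n}
    (H : Iso {k = suc k′} B Full (λ q → just (cB q)) U (Sphere U r (λ q → just (a q))) (λ q → just (a q)))
    where

    k : ℕ
    k = suc k′

    InD : Fin m → Fin k → Set
    InD i q = comp (cB q) ≡ i

    ∈-or-∉ : ∀ i q → InD i q ⊎ ¬ InD i q
    ∈-or-∉ i q = toSum (comp (cB q) ≟ i)

    Sᵣa : Fin n → Set
    Sᵣa = Sphere U r (λ q → just (a q))

    h : Fin ℓ → Fin n
    h = proj₁ H

    h-isIso : IsIso B Full (λ q → just (cB q)) U Sᵣa (λ q → just (a q)) h
    h-isIso = proj₂ H

    open Inverse h-isIso (Sphere? r _) (cB zero)
      using () renaming (inverse to h⁻¹; inverse-f to h⁻¹-h; inverse-isIso to h⁻¹-isIso)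

    h-cB : ∀ q → h (cB q) ≡ a q
    h-cB q = Maybeₚ.just-injective (IsIso.con-pres h-isIso q)

    h⁻¹-a : ∀ q → h⁻¹ (a q) ≡ cB q
    h⁻¹-a q = trans (cong h⁻¹ (sym (h-cB q))) (h⁻¹-h (cB q))

    same-component : ∀ {t x y} → Within B t x y → comp x ≡ comp y
    same-component w = proj₁ (proj₂ labelling) _ _ (_ , w)

    push-forward : ∀ {q t y} → Within B t (cB q) y → Within U t (a q) (h y)
    push-forward {q} w = subst (λ x → Within U _ x _) (h-cB q) (Within-map h (IsIso-Adj h-isIso tt tt) w)

    pull-back : ∀ {q t u} → t ≤ r → Within U t (a q) u → Within B t (cB q) (h⁻¹ u)
    pull-back {q} t≤r w = subst (λ x → Within B _ x _) (h⁻¹-a q)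
      (Within-transport Sᵣa h⁻¹ (IsIso-Adj h⁻¹-isIso)
        (λ t+u≤t w₁ _ → q , a q , refl , Within-mono (≤-trans (m≤m+n _ _) (≤-trans t+u≤t t≤r)) w₁) w)

    pull-back-2r+1 : ∀ {p q} → Within U (2 * r + 1) (a p) (a q) → Within B (2 * r + 1) (cB p) (cB q)
    pull-back-2r+1 {p} {q} w = subst₂ (Within B _) (h⁻¹-a p) (h⁻¹-a q)
      (Within-transport Sᵣa h⁻¹ (IsIso-Adj h⁻¹-isIso) near-an-end w)
      where
      near-an-end : ∀ {z t u} → t + u ≤ 2 * r + 1 → Within U t (a p) z → Within U u z (a q) → Sᵣa z
      near-an-end t+u≤ w₁ w₂ with Within-split r t+u≤ w₁ w₂
      ... | inj₁ near-p = p , a p , refl , near-p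
      ... | inj₂ near-q = q , a q , refl , near-q

    Ccon-in : ∀ {i q} → InD i q → Ccon TT r B cB comp i q ≡ just (cB q)
    Ccon-in {i} {q} q∈ =
      cong (if_then just (cB q) else nothing) (trans (isYes≗does _) (dec-true (comp (cB q) ≟ i) q∈))

    Ccon-out : ∀ {i q} → ¬ InD i q → Ccon TT r B cB comp i q ≡ nothing
    Ccon-out {i} {q} q∉ =
      cong (if_then just (cB q) else nothing) (trans (isYes≗does _) (dec-false (comp (cB q) ≟ i) q∉))

    module Component (i : Fin m) where

      nᵢ-least : ∃ λ p → InD i p × ∀ q → InD i q → toℕ p ≤ toℕ q
      nᵢ-least = least-witness (λ q → comp (cB q) ≟ i) D-nonempty
        where
        D-nonempty : ∃ (InD i)
        D-nonempty with proj₂ (proj₂ labelling) i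
        ... | x , x∈ with cover x
        ...   | q , w = q , trans (same-component w) x∈

      nᵢ : Fin k
      nᵢ = proj₁ nᵢ-least

      nᵢ-min : IsMinD TT r B cB comp i nᵢ
      nᵢ-min = proj₂ nᵢ-least

      IsMinD⇒≡nᵢ : ∀ {q} → IsMinD TT r B cB comp i q → q ≡ nᵢ
      IsMinD⇒≡nᵢ {q} (q∈ , q-min) =
        toℕ-injective (≤-antisym (q-min nᵢ (proj₁ nᵢ-min)) (proj₂ nᵢ-min q q∈))

      bᵢ : Fin n
      bᵢ = a nᵢ

      jᵢ : Fin (N TT)
      jᵢ = proj₁ (node-type bᵢ)

      πᵢ : Fin (suc (size TT jᵢ)) → Fin n
      πᵢ = π jᵢ bᵢ

      Ballᵢ : Fin n → Set
      Ballᵢ = Sphere U ρ (one bᵢ)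

      πᵢ-isIso : IsIso (str TT jᵢ) Full (one zero) U Ballᵢ (one bᵢ) πᵢ
      πᵢ-isIso = π-iso jᵢ bᵢ (proj₂ (node-type bᵢ))

      open Inverse πᵢ-isIso (Sphere? ρ (one bᵢ)) zero public
        using ()
        renaming (inverse to πᵢ⁻¹; f-inverse to πᵢ-πᵢ⁻¹; inverse-f to πᵢ⁻¹-πᵢ; inverse-isIso to πᵢ⁻¹-isIso)

      πᵢ-injective : Injective _≡_ _≡_ πᵢ
      πᵢ-injective = IsIso.inj πᵢ-isIso _ _ tt tt

      close : ∀ {q} → InD i q → Within U ((2 * r + 1) * k′) bᵢ (a q)
      close {q} q∈ = subst (Within U _ bᵢ) (h-cB q)
        (push-forward (ConstantsClose.constants-close r cB cover nᵢ q
          (proj₁ labelling _ _ (trans (proj₁ nᵢ-min) (sym q∈)))))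

      in-ball : ∀ {q t u} → InD i q → t ≤ r → Within U t (a q) u → Ballᵢ u
      in-ball q∈ t≤r w = zero , bᵢ , refl ,
        Within-mono (≤-trans (+-monoʳ-≤ _ t≤r) ρ-large) (Within-trans (close q∈) w)

      pull-backᵢ : ∀ {q t u} → InD i q → t ≤ r → Within U t (a q) u →
                   Within (str TT jᵢ) t (πᵢ⁻¹ (a q)) (πᵢ⁻¹ u)
      pull-backᵢ q∈ t≤r = Within-transport Ballᵢ πᵢ⁻¹ (IsIso-Adj πᵢ⁻¹-isIso)
        (λ t+u≤t w₁ _ → in-ball q∈ (≤-trans (m≤m+n _ _) (≤-trans t+u≤t t≤r)) w₁)

      -- aᵢ is ā restricted to Dᵢ, and σᵢ = πᵢ⁻¹ ∘ aᵢ, so that t_{bᵢ,σᵢ} = aᵢ (tpart≡aᵢ).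
      aᵢ : PTuple k n
      aᵢ q = Maybe.map h (Ccon TT r B cB comp i q)

      aᵢ-in : ∀ {q} → InD i q → aᵢ q ≡ just (a q)
      aᵢ-in {q} q∈ = trans (cong (Maybe.map h) (Ccon-in q∈)) (cong just (h-cB q))

      aᵢ-out : ∀ {q} → ¬ InD i q → aᵢ q ≡ nothing
      aᵢ-out q∉ = cong (Maybe.map h) (Ccon-out q∉)

      aᵢ-just : ∀ {q u} → aᵢ q ≡ just u → InD i q × u ≡ a q
      aᵢ-just {q} e with ∈-or-∉ i q
      ... | inj₁ q∈ = q∈ , Maybeₚ.just-injective (trans (sym e) (aᵢ-in q∈))
      ... | inj₂ q∉ = contradiction (trans (sym (aᵢ-out q∉)) e) λ ()

      σᵢ : Vec (Maybe (Fin (suc (size TT jᵢ)))) k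
      σᵢ = tabulate (Maybe.map πᵢ⁻¹ ∘ aᵢ)

      factor : Factor TT k
      factor = jᵢ , σᵢ

      σᵢ-in : ∀ {q} → InD i q → lookup σᵢ q ≡ just (πᵢ⁻¹ (a q))
      σᵢ-in {q} q∈ = trans (lookup∘tabulate (Maybe.map πᵢ⁻¹ ∘ aᵢ) q) (cong (Maybe.map πᵢ⁻¹) (aᵢ-in q∈))

      σᵢ-out : ∀ {q} → ¬ InD i q → lookup σᵢ q ≡ nothing
      σᵢ-out {q} q∉ = trans (lookup∘tabulate (Maybe.map πᵢ⁻¹ ∘ aᵢ) q) (cong (Maybe.map πᵢ⁻¹) (aᵢ-out q∉))

      tpart≡aᵢ : ∀ q → tpart TT π bᵢ factor q ≡ aᵢ q
      tpart≡aᵢ q with ∈-or-∉ i q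
      ... | inj₁ q∈ = begin
        Maybe.map πᵢ (lookup σᵢ q)   ≡⟨ cong (Maybe.map πᵢ) (σᵢ-in q∈) ⟩
        just (πᵢ (πᵢ⁻¹ (a q)))       ≡⟨ cong just (πᵢ-πᵢ⁻¹ (in-ball q∈ z≤n here)) ⟩
        just (a q)                   ≡⟨ aᵢ-in q∈ ⟨
        aᵢ q                         ∎
        where open ≡-Reasoning
      ... | inj₂ q∉ = trans (cong (Maybe.map πᵢ) (σᵢ-out q∉)) (sym (aᵢ-out q∉))

      -- Both factors are restricted to Sᵣ(aᵢ) ⊆ U, which lies inside the ρ-ball of bᵢ.
      component-isIso : IsIso (str TT jᵢ) (Sphere (str TT jᵢ) r (lookup σᵢ)) (lookup σᵢ)
                              B (λ x → comp x ≡ i) (Ccon TT r B cB comp i) (h⁻¹ ∘ πᵢ)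
      component-isIso = IsIso-∘ (IsIso-restrict πᵢ-isIso _ into₁ surj₁ tpart≡aᵢ)
                                (IsIso-restrict h⁻¹-isIso near₂ into₂ surj₂
                                                (map-inverseˡ h⁻¹-h ∘ Ccon TT r B cB comp i))
        where
        into₁ : ∀ {x} → Sphere (str TT jᵢ) r (lookup σᵢ) x → Sphere U r aᵢ (πᵢ x)
        into₁ (q , y , e , w) = q , πᵢ y , trans (sym (tpart≡aᵢ q)) (cong (Maybe.map πᵢ) e) ,
                                Within-map πᵢ (IsIso-Adj πᵢ-isIso tt tt) w
        surj₁ : ∀ {u} → Sphere U r aᵢ u → ∃ λ x → Sphere (str TT jᵢ) r (lookup σᵢ) x × πᵢ x ≡ u
        surj₁ (q , y , e , w) with aᵢ-just e
        ... | q∈ , refl =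
          πᵢ⁻¹ _ , (q , πᵢ⁻¹ y , σᵢ-in q∈ , pull-backᵢ q∈ ≤-refl w) , πᵢ-πᵢ⁻¹ (in-ball q∈ ≤-refl w)
        near₂ : ∀ {u} → Sphere U r aᵢ u → Sᵣa u
        near₂ (q , y , e , w) with aᵢ-just e
        ... | _ , refl = q , y , refl , w
        into₂ : ∀ {u} → Sphere U r aᵢ u → comp (h⁻¹ u) ≡ i
        into₂ (q , y , e , w) with aᵢ-just e
        ... | q∈ , refl = trans (sym (same-component (pull-back ≤-refl w))) q∈
        surj₂ : ∀ {x} → comp x ≡ i → ∃ λ u → Sphere U r aᵢ u × h⁻¹ u ≡ x
        surj₂ {x} x∈ with cover x
        ... | q , w = h x , (q , a q , aᵢ-in (trans (same-component w) x∈) , push-forward w) , h⁻¹-h x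

      consistent : (∀ q → InD i q → ∃ λ x → lookup σᵢ q ≡ just x) ×
                   (∀ q → ¬ InD i q → lookup σᵢ q ≡ nothing) ×
                   (∀ q → IsMinD TT r B cB comp i q → lookup σᵢ q ≡ just zero) ×
                   Iso (str TT jᵢ) (Sphere (str TT jᵢ) r (lookup σᵢ)) (lookup σᵢ)
                       B (λ x → comp x ≡ i) (Ccon TT r B cB comp i)
      consistent = (λ q q∈ → _ , σᵢ-in q∈) , (λ q → σᵢ-out) , σᵢ-min , _ , component-isIso
        where
        σᵢ-min : ∀ q → IsMinD TT r B cB comp i q → lookup σᵢ q ≡ just zero
        σᵢ-min q q-min rewrite IsMinD⇒≡nᵢ q-min = begin
          lookup σᵢ nᵢ         ≡⟨ σᵢ-in (proj₁ nᵢ-min) ⟩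
          just (πᵢ⁻¹ bᵢ)       ≡⟨ cong (just ∘ πᵢ⁻¹) (Maybeₚ.just-injective (IsIso.con-pres πᵢ-isIso zero)) ⟨
          just (πᵢ⁻¹ (πᵢ zero)) ≡⟨ cong just (πᵢ⁻¹-πᵢ zero) ⟩
          just zero             ∎
          where open ≡-Reasoning

      factor-unique : ∀ {j σ} → j ≡ jᵢ → (∀ q → tpart TT π bᵢ (j , σ) q ≡ aᵢ q) →
                      _≡_ {A = Factor TT k} (j , σ) factor
      factor-unique refl same-tpart =
        cong (jᵢ ,_) (Vec-ext λ q → Maybeₚ.map-injective πᵢ-injective (trans (same-tpart q) (sym (tpart≡aᵢ q))))

    aᵢ-nothing-or-a : ∀ i q → Component.aᵢ i q ≡ nothing ⊎ Component.aᵢ i q ≡ just (a q)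
    aᵢ-nothing-or-a i q = Data.Sum.map (Component.aᵢ-out i) (Component.aᵢ-in i) (Data.Sum.swap (∈-or-∉ i q))

    Λ : Vec (Factor TT k) m
    Λ = tabulate Component.factor

    b̄ : Vec (Fin n) m
    b̄ = tabulate Component.bᵢ

    tpart-Λ : ∀ i q → tpart TT π (lookup b̄ i) (lookup Λ i) q ≡ Component.aᵢ i q
    tpart-Λ i q rewrite lookup∘tabulate Component.factor i | lookup∘tabulate Component.bᵢ i =
      Component.tpart≡aᵢ i q

    consistent : ConsistentFact TT r B cB comp Λ
    consistent i rewrite lookup∘tabulate Component.factor i = Component.consistent i

    admissible : Admissible TT r B cB comp U π Λ b̄
    admissible = nodes , far-apart
      where
      nodes : ∀ i → IsNode TT U (proj₁ (lookup Λ i)) (lookup b̄ i)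
      nodes i rewrite lookup∘tabulate Component.factor i | lookup∘tabulate Component.bᵢ i =
        proj₂ (node-type (Component.bᵢ i))
      far-apart : ∀ i i′ → i ≢ i′ → DistGt U (2 * r + 1) (tpart TT π (lookup b̄ i) (lookup Λ i))
                                                       (tpart TT π (lookup b̄ i′) (lookup Λ i′))
      far-apart i i′ i≢i′ p q x y e e′ w
        with Component.aᵢ-just i (trans (sym (tpart-Λ i p)) e)
           | Component.aᵢ-just i′ (trans (sym (tpart-Λ i′ q)) e′)
      ... | p∈ , refl | q∈ , refl = i≢i′ (trans (sym p∈) (trans (same-component (pull-back-2r+1 w)) q∈))

    apply≡a : ∀ p → apply TT π Λ b̄ p ≡ just (a p)
    apply≡a p = foldr-<∣>-≡ (λ i → tpart TT π (lookup b̄ i) (lookup Λ i) p)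
      (λ i → Data.Sum.map (trans (tpart-Λ i p)) (trans (tpart-Λ i p)) (aᵢ-nothing-or-a i p))
      (∈-allFin (comp (cB p))) (trans (tpart-Λ _ p) (Component.aᵢ-in _ refl))

    module Uniqueness (Λ′ : Vec (Factor TT k) m) (b′ : Vec (Fin n) m)
                      (consistent′ : ConsistentFact TT r B cB comp Λ′)
                      (nodes′ : ∀ i → IsNode TT U (proj₁ (lookup Λ′ i)) (lookup b′ i))
                      (apply′≡a : ∀ p → apply TT π Λ′ b′ p ≡ just (a p)) (i : Fin m) where
      open Component i

      tpart′ : Fin m → PTuple k n
      tpart′ i″ = tpart TT π (lookup b′ i″) (lookup Λ′ i″)

      tpart′-out : ∀ {i″ q} → ¬ InD i″ q → tpart′ i″ q ≡ nothing
      tpart′-out {i″} {q} q∉ = cong (Maybe.map _) (proj₁ (proj₂ (consistent′ i″)) q q∉)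

      tpart′≡aᵢ : ∀ q → tpart′ i q ≡ aᵢ q
      tpart′≡aᵢ q with ∈-or-∉ i q
      ... | inj₂ q∉ = trans (tpart′-out q∉) (sym (aᵢ-out q∉))
      ... | inj₁ q∈ = begin
        tpart′ i q            ≡⟨ foldr-<∣>-≡ (λ i″ → tpart′ i″ q) only-i (∈-allFin i) refl ⟨
        apply TT π Λ′ b′ q    ≡⟨ apply′≡a q ⟩
        just (a q)            ≡⟨ aᵢ-in q∈ ⟨
        aᵢ q                  ∎
        where
        open ≡-Reasoning
        only-i : ∀ i″ → tpart′ i″ q ≡ nothing ⊎ tpart′ i″ q ≡ tpart′ i q
        only-i i″ with i″ ≟ i
        ... | yes refl = inj₂ refl
        ... | no i″≢i  = inj₁ (tpart′-out λ q∈i″ → i″≢i (trans (sym q∈i″) q∈))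

      b′≡bᵢ : lookup b′ i ≡ bᵢ
      b′≡bᵢ = Maybeₚ.just-injective (begin
        just (lookup b′ i)                          ≡⟨ IsIso.con-pres (π-iso _ _ (nodes′ i)) zero ⟨
        Maybe.map (π _ (lookup b′ i)) (just zero)   ≡⟨ cong (Maybe.map _) σ′ᵢ-nᵢ ⟨
        tpart′ i nᵢ                                 ≡⟨ tpart′≡aᵢ nᵢ ⟩
        aᵢ nᵢ                                       ≡⟨ aᵢ-in (proj₁ nᵢ-min) ⟩
        just bᵢ                                     ∎)
        where
        open ≡-Reasoning
        σ′ᵢ-nᵢ : lookup (proj₂ (lookup Λ′ i)) nᵢ ≡ just zero
        σ′ᵢ-nᵢ = proj₁ (proj₂ (proj₂ (consistent′ i))) nᵢ nᵢ-min

      j′≡jᵢ : proj₁ (lookup Λ′ i) ≡ jᵢ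
      j′≡jᵢ with subst (IsNode TT U (proj₁ (lookup Λ′ i))) b′≡bᵢ (nodes′ i)
      ... | _ , I = distinct TT _ _ (_ , IsIso-∘ I πᵢ⁻¹-isIso)

      Λ′≡factor : lookup Λ′ i ≡ factor
      Λ′≡factor = factor-unique j′≡jᵢ λ q →
        trans (cong (λ b → tpart TT π b (lookup Λ′ i) q) (sym b′≡bᵢ)) (tpart′≡aᵢ q)

    unique : ∀ Λ′ b′ → ConsistentFact TT r B cB comp Λ′ × Admissible TT r B cB comp U π Λ′ b′ ×
             (∀ p → apply TT π Λ′ b′ p ≡ just (a p)) → Λ′ ≡ Λ × b′ ≡ b̄
    unique Λ′ b′ (consistent′ , (nodes′ , _) , apply′≡a) =
      Vec-ext (λ i → trans (Λ′≡factor i) (sym (lookup∘tabulate Component.factor i))) ,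
      Vec-ext (λ i → trans (b′≡bᵢ i) (sym (lookup∘tabulate Component.bᵢ i)))
      where open Uniqueness Λ′ b′ consistent′ nodes′ apply′≡a

ρ≡ : ∀ r k′ → (2 * r + 1) * k′ + r ≡ 2 * r * suc k′ ∸ r + suc k′ ∸ 1
ρ≡ r k′ = sym (begin
  2 * r * suc k′ ∸ r + suc k′ ∸ 1         ≡⟨ cong (λ x → x ∸ r + suc k′ ∸ 1) (eq₁ r k′) ⟩
  2 * r * k′ + r + r ∸ r + suc k′ ∸ 1     ≡⟨ cong (λ x → x + suc k′ ∸ 1) (m+n∸n≡m (2 * r * k′ + r) r) ⟩
  2 * r * k′ + r + suc k′ ∸ 1             ≡⟨ cong (_∸ 1) (+-suc (2 * r * k′ + r) k′) ⟩
  2 * r * k′ + r + k′                     ≡⟨ eq₂ r k′ ⟩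
  (2 * r + 1) * k′ + r                    ∎)
  where
  open ≡-Reasoning
  eq₁ : ∀ r k′ → 2 * r * suc k′ ≡ 2 * r * k′ + r + r
  eq₁ = solve-∀
  eq₂ : ∀ r k′ → 2 * r * k′ + r + k′ ≡ (2 * r + 1) * k′ + r
  eq₂ = solve-∀

lemma3 : {S : Sig} (d k r : ℕ) → 2 ≤ d → 1 ≤ k → 1 ≤ r →
  (TT : Reps {S} d (2 * r * k ∸ r + k ∸ 1)) →
  (n : ℕ) (U : Struct S n) → Bounded d U →
  (π : (j : Fin (N TT)) → Fin n → Fin (suc (size TT j)) → Fin n) → PiSpec TT U π →
  (ℓ : ℕ) (B : Struct S ℓ) (cB : Fin k → Fin ℓ) → IsNType d k r B cB →
  (∀ i → toℕ (cB i) ≡ toℕ i) →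
  (m : ℕ) (comp : Fin ℓ → Fin m) → ComponentLabeling B comp →
  (a : Fin k → Fin n) →
  Iso {k = k} B Full (λ i → just (cB i)) U (Sphere U r (λ i → just (a i))) (λ i → just (a i)) →
  Σ (Vec (Factor TT k) m × Vec (Fin n) m) λ { (Λ , b) →
    (ConsistentFact TT r B cB comp Λ × Admissible TT r B cB comp U π Λ b ×
     (∀ p → apply TT π Λ b p ≡ just (a p))) ×
    (∀ Λ' b' → ConsistentFact TT r B cB comp Λ' × Admissible TT r B cB comp U π Λ' b' ×
       (∀ p → apply TT π Λ' b' p ≡ just (a p)) → Λ' ≡ Λ × b' ≡ b) }
lemma3 d zero r _ ()
-- Neither r ≥ 1 nor the convention that cᵢ is interpreted by i is needed.
lemma3 d (suc k′) r 2≤d _ _ TT n U bounded π π-iso ℓ B cB (_ , _ , cover) _ m comp labelling a H =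
  (Λ , b̄) , (consistent , admissible , apply≡a) , unique
  where
  open Factorization TT π π-iso (node-type-exists TT 2≤d bounded) (≤-reflexive (ρ≡ r k′)) cover labelling H
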